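{- Let $p$ be a prime, let $K$ be a field of characteristic $p$, and let $f,g\in K[x]$ be polynomials of the same degree $d\ge 2$. Let $\alpha,\beta\in K$ be such that $\alpha$ is not preperiodic for $f$ and $f^n(\alpha)=g^n(\beta)$ for infinitely many $n\in\mathbb{N}$. Suppose there exist integers $a>0$ and $b\ge 0$ such that $f^{an+b}(\alpha)=g^{an+b}(\beta)$ for all $n\in\mathbb{N}_0$. Then $f$ and $g$ share a common iterate; in fact $f^a=g^a$.
   Context: $\mathbb{N}_0$ denotes the non-negative integers and $\mathbb{N}$ the positive integers. For a polynomial $f$, $f^n$ denotes its $n$-th compositional iterate ($f^0$ the identity). A point $\alpha$ is preperiodic for $f$ if $f^m(\alpha)=f^n(\alpha)$ for some $0\le m<n$, i.e. its orbit $\{f^n(\alpha)\colon n\ge0\}$ is finite. -}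

module Defs where

open import Level using (Level; _⊔_; suc)
open import Algebra.Bundles using (CommutativeRing)
open import Data.Nat as ℕ using (ℕ; zero; suc)
open import Data.List using (List; []; _∷_)
open import Data.Product using (Σ; ∃; _×_; _,_)
open import Relation.Nullary using (¬_)

record Field (c ℓ : Level) : Set (Level.suc (c ⊔ ℓ)) where
  field
    commutativeRing : CommutativeRing c ℓ
  open CommutativeRing commutativeRing public
  field
    0≉1     : ¬ (0# ≈ 1#)
    inverse : ∀ x → ¬ (x ≈ 0#) → Σ Carrier λ y → (x * y) ≈ 1#

module _ {c ℓ : Level} (K : Field c ℓ) where
  open Field K

  natK : ℕ → Carrier
  natK zero    = 0#
  natK (suc n) = 1# + natK n

  HasCharacteristic : ℕ → Set ℓ
  HasCharacteristic p = natK p ≈ 0#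

  -- Polynomials in K[x]: coefficient lists, lowest degree first.
  Poly : Set c
  Poly = List Carrier

  coeff : Poly → ℕ → Carrier
  coeff []       _       = 0#
  coeff (a ∷ f)  zero    = a
  coeff (a ∷ f)  (suc i) = coeff f i

  -- equality of polynomials: all coefficients agree (trailing zeros ignored)
  _≈ₚ_ : Poly → Poly → Set ℓ
  f ≈ₚ g = ∀ i → coeff f i ≈ coeff g i

  HasDegree : Poly → ℕ → Set ℓ
  HasDegree f d = ¬ (coeff f d ≈ 0#) × (∀ i → d ℕ.< i → coeff f i ≈ 0#)

  _+ₚ_ : Poly → Poly → Poly
  []      +ₚ g       = g
  (a ∷ f) +ₚ []      = a ∷ f
  (a ∷ f) +ₚ (b ∷ g) = (a + b) ∷ (f +ₚ g)

  scale : Carrier → Poly → Poly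
  scale a []      = []
  scale a (b ∷ g) = (a * b) ∷ scale a g

  _*ₚ_ : Poly → Poly → Poly
  []      *ₚ g = []
  (a ∷ f) *ₚ g = scale a g +ₚ (0# ∷ (f *ₚ g))

  -- composition: compose f g = f ∘ g = f(g(x))
  compose : Poly → Poly → Poly
  compose []      g = []
  compose (a ∷ f) g = (a ∷ []) +ₚ (g *ₚ compose f g)

  X : Poly
  X = 0# ∷ 1# ∷ []

  iterP : ℕ → Poly → Poly
  iterP zero    f = X
  iterP (suc n) f = compose f (iterP n f)

  eval : Poly → Carrier → Carrier
  eval []      x = 0#
  eval (a ∷ f) x = a + x * eval f x

  orbit : Poly → ℕ → Carrier → Carrier
  orbit f zero    α = α
  orbit f (suc n) α = eval f (orbit f n α)

  Preperiodic : Poly → Carrier → Set ℓ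
  Preperiodic f α = ∃ λ m → ∃ λ n → m ℕ.< n × orbit f m α ≈ orbit f n α

-- Put F = f^a and G = g^a and γₙ = f^(an+b)(α). Since f^(an+b)(α) = g^(an+b)(β)
-- for every n, both F and G send γₙ to γₙ₊₁. As α is not preperiodic, the points
-- γₙ are pairwise distinct, so the polynomial F − G has infinitely many roots;
-- peeling them off one at a time by synthetic division shows that it is zero.
module Submission where

open import Defs
open import Level using (Level)
import Data.Nat as ℕ
open ℕ using (ℕ; zero; suc)
open import Data.Nat.Properties using (suc-injective)
open import Data.List using ([]; _∷_; length)
open import Data.Maybe using (nothing)
open import Data.Product using (∃; _×_; _,_)
open import Function using (_∘_)
open import Relation.Nullary using (¬_)
import Relation.Binary.PropositionalEquality as ≡
import Relation.Binary.Reasoning.Setoid as SetoidReasoning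
open import Tactic.RingSolver.Core.AlmostCommutativeRing using (AlmostCommutativeRing; fromCommutativeRing)
import Tactic.RingSolver.NonReflective as RingSolver
import Algebra.Properties.Group as GroupProperties
import Algebra.Properties.Ring as RingProperties

module _ {c ℓ : Level} (K : Field c ℓ) where
  open Field K
  open SetoidReasoning setoid
  open GroupProperties +-group using (x∙y⁻¹≈ε⇒x≈y; x≈y⇒x∙y⁻¹≈ε)
  open RingProperties ring using (-1*x≈-x)

  -- No zero test is supplied, so the solver can only close identities that
  -- need no cancellation of coefficients; it is used on semiring identities.
  private
    almostCommutativeRing : AlmostCommutativeRing c ℓ
    almostCommutativeRing = fromCommutativeRing commutativeRing (λ _ → nothing)

  open RingSolver almostCommutativeRing using (solve; _⊜_; _⊕_; _⊗_)

  x≉0∧x*y≈0⇒y≈0 : ∀ {x y} → ¬ x ≈ 0# → x * y ≈ 0# → y ≈ 0#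
  x≉0∧x*y≈0⇒y≈0 {x} {y} x≉0 xy≈0 with inverse x x≉0
  ... | x⁻¹ , xx⁻¹≈1 = begin
    y               ≈⟨ *-identityˡ y ⟨
    1# * y          ≈⟨ *-congʳ (trans (*-comm x⁻¹ x) xx⁻¹≈1) ⟨
    (x⁻¹ * x) * y   ≈⟨ *-assoc x⁻¹ x y ⟩
    x⁻¹ * (x * y)   ≈⟨ *-congˡ xy≈0 ⟩
    x⁻¹ * 0#        ≈⟨ zeroʳ x⁻¹ ⟩
    0#              ∎

  Distinct : (ℕ → Carrier) → Set ℓ
  Distinct r = ∀ {i j} → i ℕ.< j → ¬ r i ≈ r j

  eval-cong : ∀ Q {x y} → x ≈ y → eval K Q x ≈ eval K Q y
  eval-cong []      x≈y = refl
  eval-cong (a ∷ Q) x≈y = +-congˡ (*-cong x≈y (eval-cong Q x≈y))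

  eval-+ₚ : ∀ Q R x → eval K (_+ₚ_ K Q R) x ≈ eval K Q x + eval K R x
  eval-+ₚ []      R       x = sym (+-identityˡ _)
  eval-+ₚ (a ∷ Q) []      x = sym (+-identityʳ _)
  eval-+ₚ (a ∷ Q) (b ∷ R) x = begin
    (a + b) + x * eval K (_+ₚ_ K Q R) x         ≈⟨ +-congˡ (*-congˡ (eval-+ₚ Q R x)) ⟩
    (a + b) + x * (eval K Q x + eval K R x)     ≈⟨ solve 5 (λ a b x u v → ((a ⊕ b) ⊕ x ⊗ (u ⊕ v)) ⊜ ((a ⊕ x ⊗ u) ⊕ (b ⊕ x ⊗ v)))
                                                      refl a b x (eval K Q x) (eval K R x) ⟩
    (a + x * eval K Q x) + (b + x * eval K R x) ∎

  eval-scale : ∀ a Q x → eval K (scale K a Q) x ≈ a * eval K Q x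
  eval-scale a []      x = sym (zeroʳ a)
  eval-scale a (b ∷ Q) x = begin
    a * b + x * eval K (scale K a Q) x ≈⟨ +-congˡ (*-congˡ (eval-scale a Q x)) ⟩
    a * b + x * (a * eval K Q x)       ≈⟨ solve 4 (λ a b x u → (a ⊗ b ⊕ x ⊗ (a ⊗ u)) ⊜ (a ⊗ (b ⊕ x ⊗ u)))
                                             refl a b x (eval K Q x) ⟩
    a * (b + x * eval K Q x)           ∎

  eval-*ₚ : ∀ Q R x → eval K (_*ₚ_ K Q R) x ≈ eval K Q x * eval K R x
  eval-*ₚ []      R x = sym (zeroˡ _)
  eval-*ₚ (a ∷ Q) R x = begin
    eval K (_+ₚ_ K (scale K a R) (0# ∷ _*ₚ_ K Q R)) x         ≈⟨ eval-+ₚ (scale K a R) _ x ⟩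
    eval K (scale K a R) x + (0# + x * eval K (_*ₚ_ K Q R) x) ≈⟨ +-cong (eval-scale a R x) (+-identityˡ _) ⟩
    a * eval K R x + x * eval K (_*ₚ_ K Q R) x                ≈⟨ +-congˡ (*-congˡ (eval-*ₚ Q R x)) ⟩
    a * eval K R x + x * (eval K Q x * eval K R x)            ≈⟨ +-congˡ (*-assoc x _ _) ⟨
    a * eval K R x + (x * eval K Q x) * eval K R x            ≈⟨ distribʳ (eval K R x) a _ ⟨
    (a + x * eval K Q x) * eval K R x                         ∎

  eval-compose : ∀ Q R x → eval K (compose K Q R) x ≈ eval K Q (eval K R x)
  eval-compose []      R x = refl
  eval-compose (a ∷ Q) R x = begin
    eval K (_+ₚ_ K (a ∷ []) (_*ₚ_ K R (compose K Q R))) x  ≈⟨ eval-+ₚ (a ∷ []) (_*ₚ_ K R (compose K Q R)) x ⟩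
    (a + x * 0#) + eval K (_*ₚ_ K R (compose K Q R)) x    ≈⟨ +-cong (trans (+-congˡ (zeroʳ x)) (+-identityʳ a)) (eval-*ₚ R _ x) ⟩
    a + eval K R x * eval K (compose K Q R) x             ≈⟨ +-congˡ (*-congˡ (eval-compose Q R x)) ⟩
    a + eval K R x * eval K Q (eval K R x)                ∎

  eval-X : ∀ x → eval K (X K) x ≈ x
  eval-X x = begin
    0# + x * (1# + x * 0#) ≈⟨ +-identityˡ _ ⟩
    x * (1# + x * 0#)      ≈⟨ *-congˡ (trans (+-congˡ (zeroʳ x)) (+-identityʳ 1#)) ⟩
    x * 1#                 ≈⟨ *-identityʳ x ⟩
    x                      ∎

  eval-iterP : ∀ n f x → eval K (iterP K n f) x ≈ orbit K f n x
  eval-iterP zero    f x = eval-X x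
  eval-iterP (suc n) f x = trans (eval-compose f (iterP K n f) x) (eval-cong f (eval-iterP n f x))

  y+[x-y]≈x : ∀ x y → y + (x + - y) ≈ x
  y+[x-y]≈x x y = begin
    y + (x + - y) ≈⟨ +-comm y _ ⟩
    (x + - y) + y ≈⟨ +-assoc x (- y) y ⟩
    x + (- y + y) ≈⟨ +-congˡ (-‿inverseˡ y) ⟩
    x + 0#        ≈⟨ +-identityʳ x ⟩
    x             ∎

  quotient : Carrier → Poly K → Poly K
  quotient r []      = []
  quotient r (b ∷ S) = eval K (b ∷ S) r ∷ quotient r S

  eval-quotient : ∀ r a S x → eval K (a ∷ S) x ≈ eval K (a ∷ S) r + (x + - r) * eval K (quotient r S) x
  eval-quotient r a []      x = begin
    a + x * 0#                        ≈⟨ +-congˡ (zeroʳ x) ⟩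
    a + 0#                            ≈⟨ +-cong (trans (+-congˡ (zeroʳ r)) (+-identityʳ a)) (zeroʳ _) ⟨
    (a + r * 0#) + (x + - r) * 0#     ∎
  eval-quotient r a (b ∷ S) x = begin
    a + x * eval K (b ∷ S) x          ≈⟨ +-congˡ (*-congˡ (eval-quotient r b S x)) ⟩
    a + x * (s + t * q)               ≈⟨ +-congˡ (distribˡ x s (t * q)) ⟩
    a + (x * s + x * (t * q))         ≈⟨ +-congˡ (+-congʳ (*-congʳ (y+[x-y]≈x x r))) ⟨
    a + ((r + t) * s + x * (t * q))   ≈⟨ solve 6 (λ a r t s x q → (a ⊕ ((r ⊕ t) ⊗ s ⊕ x ⊗ (t ⊗ q))) ⊜ ((a ⊕ r ⊗ s) ⊕ t ⊗ (s ⊕ x ⊗ q)))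
                                           refl a r t s x q ⟩
    (a + r * s) + t * (s + x * q)     ∎
    where
    s t q : Carrier
    s = eval K (b ∷ S) r
    t = x + - r
    q = eval K (quotient r S) x

  length-quotient : ∀ r S → length (quotient r S) ≡.≡ length S
  length-quotient r []      = ≡.refl
  length-quotient r (b ∷ S) = ≡.cong suc (length-quotient r S)

  eval-≈0 : ∀ Q x → _≈ₚ_ K Q [] → eval K Q x ≈ 0#
  eval-≈0 []      x _   = refl
  eval-≈0 (a ∷ Q) x Q≈0 = begin
    a + x * eval K Q x ≈⟨ +-cong (Q≈0 0) (*-congˡ (eval-≈0 Q x (Q≈0 ∘ suc))) ⟩
    0# + x * 0#        ≈⟨ +-identityˡ _ ⟩
    x * 0#             ≈⟨ zeroʳ x ⟩
    0#                 ∎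

  ∷-≈0 : ∀ {a S r} → eval K (a ∷ S) r ≈ 0# → _≈ₚ_ K S [] → _≈ₚ_ K (a ∷ S) []
  ∷-≈0 {a} {S} {r} a∷S[r]≈0 S≈0 zero = begin
    a                  ≈⟨ +-identityʳ a ⟨
    a + 0#             ≈⟨ +-congˡ (trans (*-congˡ (eval-≈0 S r S≈0)) (zeroʳ r)) ⟨
    a + r * eval K S r ≈⟨ a∷S[r]≈0 ⟩
    0#                 ∎
  ∷-≈0 _ S≈0 (suc i) = S≈0 i

  quotient-≈0 : ∀ r S → _≈ₚ_ K (quotient r S) [] → _≈ₚ_ K S []
  quotient-≈0 r []      _   _ = refl
  quotient-≈0 r (b ∷ S) q≈0   = ∷-≈0 (q≈0 0) (quotient-≈0 r S (q≈0 ∘ suc))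

  vanishing⇒≈0 : ∀ Q r → Distinct r → (∀ i → eval K Q (r i) ≈ 0#) → _≈ₚ_ K Q []
  vanishing⇒≈0 Q = go (length Q) Q ≡.refl
    where
    go : ∀ n Q → length Q ≡.≡ n → ∀ r → Distinct r → (∀ i → eval K Q (r i) ≈ 0#) → _≈ₚ_ K Q []
    go _       []      _          _ _          _       _ = refl
    go (suc n) (a ∷ S) |a∷S|≡1+n r r-distinct Q[r]≈0 = ∷-≈0 (Q[r]≈0 0) (quotient-≈0 (r 0) S q≈0)
      where
      q : Poly K
      q = quotient (r 0) S

      q-vanishes : ∀ i → eval K q (r (suc i)) ≈ 0#
      q-vanishes i = x≉0∧x*y≈0⇒y≈0 (r-distinct ℕ.z<s ∘ sym ∘ x∙y⁻¹≈ε⇒x≈y _ _) (begin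
        (x + - r 0) * eval K q x                        ≈⟨ +-identityˡ _ ⟨
        0# + (x + - r 0) * eval K q x                   ≈⟨ +-congʳ (Q[r]≈0 0) ⟨
        eval K (a ∷ S) (r 0) + (x + - r 0) * eval K q x ≈⟨ eval-quotient (r 0) a S x ⟨
        eval K (a ∷ S) x                                ≈⟨ Q[r]≈0 (suc i) ⟩
        0#                                              ∎)
        where
        x : Carrier
        x = r (suc i)

      q≈0 : _≈ₚ_ K q []
      q≈0 = go n q (≡.trans (length-quotient (r 0) S) (suc-injective |a∷S|≡1+n))
        (r ∘ suc) (r-distinct ∘ ℕ.s≤s) q-vanishes

  _-ₚ_ : Poly K → Poly K → Poly K
  F -ₚ G = _+ₚ_ K F (scale K (- 1#) G)

  eval--ₚ : ∀ F G x → eval K (F -ₚ G) x ≈ eval K F x + - eval K G x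
  eval--ₚ F G x = trans (eval-+ₚ F _ x) (+-congˡ (trans (eval-scale (- 1#) G x) (-1*x≈-x _)))

  coeff-+ₚ : ∀ Q R i → coeff K (_+ₚ_ K Q R) i ≈ coeff K Q i + coeff K R i
  coeff-+ₚ []      R       i       = sym (+-identityˡ _)
  coeff-+ₚ (a ∷ Q) []      i       = sym (+-identityʳ _)
  coeff-+ₚ (a ∷ Q) (b ∷ R) zero    = refl
  coeff-+ₚ (a ∷ Q) (b ∷ R) (suc i) = coeff-+ₚ Q R i

  coeff-scale : ∀ a Q i → coeff K (scale K a Q) i ≈ a * coeff K Q i
  coeff-scale a []      i       = sym (zeroʳ a)
  coeff-scale a (b ∷ Q) zero    = refl
  coeff-scale a (b ∷ Q) (suc i) = coeff-scale a Q i

  coeff--ₚ : ∀ F G i → coeff K (F -ₚ G) i ≈ coeff K F i + - coeff K G i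
  coeff--ₚ F G i = trans (coeff-+ₚ F _ i) (+-congˡ (trans (coeff-scale (- 1#) G i) (-1*x≈-x _)))

  agreeing⇒≈ₚ : ∀ F G r → Distinct r → (∀ i → eval K F (r i) ≈ eval K G (r i)) → _≈ₚ_ K F G
  agreeing⇒≈ₚ F G r r-distinct F[r]≈G[r] i = x∙y⁻¹≈ε⇒x≈y _ _ (begin
    coeff K F i + - coeff K G i ≈⟨ coeff--ₚ F G i ⟨
    coeff K (F -ₚ G) i          ≈⟨ vanishing⇒≈0 (F -ₚ G) r r-distinct F-G[r]≈0 i ⟩
    0#                          ∎)
    where
    F-G[r]≈0 : ∀ j → eval K (F -ₚ G) (r j) ≈ 0#
    F-G[r]≈0 j = trans (eval--ₚ F G (r j)) (x≈y⇒x∙y⁻¹≈ε (F[r]≈G[r] j))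

open import Data.Nat using (_+_; _*_; _<_; _≤_)
open import Data.Nat.Properties using (+-assoc; *-suc; +-monoˡ-<; *-monoʳ-<)
open import Data.Nat.Primality using (Prime)

module _ {c ℓ : Level} (K : Field c ℓ) where
  open Field K using (_≈_; trans; reflexive)

  orbit-+ : ∀ f m k x → orbit K f (m + k) x ≡.≡ orbit K f m (orbit K f k x)
  orbit-+ f zero    k x = ≡.refl
  orbit-+ f (suc m) k x = ≡.cong (eval K f) (orbit-+ f m k x)

  iterP-progression : ∀ f a b n x →
    eval K (iterP K a f) (orbit K f (a * n + b) x) ≈ orbit K f (a * suc n + b) x
  iterP-progression f a b n x = trans (eval-iterP K a f _) (reflexive (begin
    orbit K f a (orbit K f (a * n + b) x) ≡⟨ orbit-+ f a (a * n + b) x ⟨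
    orbit K f (a + (a * n + b)) x         ≡⟨ ≡.cong (λ m → orbit K f m x) (+-assoc a (a * n) b) ⟨
    orbit K f (a + a * n + b) x           ≡⟨ ≡.cong (λ m → orbit K f (m + b) x) (*-suc a n) ⟨
    orbit K f (a * suc n + b) x           ∎))
    where open ≡.≡-Reasoning

lemma4p3 : ∀ {c ℓ : Level} (K : Field c ℓ) (p : ℕ) → Prime p → HasCharacteristic K p →
    (f g : Poly K) (d : ℕ) → 2 ≤ d → HasDegree K f d → HasDegree K g d →
    (α β : Field.Carrier K) →
    ¬ Preperiodic K f α →
    (∀ N → ∃ λ n → N < n × Field._≈_ K (orbit K f n α) (orbit K g n β)) →
    (a b : ℕ) → 0 < a →
    (∀ n → Field._≈_ K (orbit K f (a * n + b) α) (orbit K g (a * n + b) β)) →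
    _≈ₚ_ K (iterP K a f) (iterP K a g)
lemma4p3 K _ _ _ f g _ _ _ _ α β α-notPreperiodic _ a b 0<a agree =
  agreeing⇒≈ₚ K (iterP K a f) (iterP K a g) γ γ-distinct F[γ]≈G[γ]
  where
  open Field K using (Carrier; _≈_; setoid)
  open SetoidReasoning setoid

  γ : ℕ → Carrier
  γ n = orbit K f (a * n + b) α

  γ-distinct : Distinct K γ
  γ-distinct i<j γi≈γj =
    α-notPreperiodic (_ , _ , +-monoˡ-< b (*-monoʳ-< a {{ℕ.>-nonZero 0<a}} i<j) , γi≈γj)

  F[γ]≈G[γ] : ∀ n → eval K (iterP K a f) (γ n) ≈ eval K (iterP K a g) (γ n)
  F[γ]≈G[γ] n = begin
    eval K (iterP K a f) (γ n)                         ≈⟨ iterP-progression K f a b n α ⟩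
    γ (suc n)                                          ≈⟨ agree (suc n) ⟩
    orbit K g (a * suc n + b) β                        ≈⟨ iterP-progression K g a b n β ⟨
    eval K (iterP K a g) (orbit K g (a * n + b) β)     ≈⟨ eval-cong K (iterP K a g) (agree n) ⟨
    eval K (iterP K a g) (γ n)                         ∎
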